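{- Let $R$ be a $\mathbb{Q}$-algebra and $h\in R\langle\langle e_0,e_1\rangle\rangle$ a Lie series. Then for all $w,w'\in\mathcal{H}_{\ast}$ we have in $R[[T]]$: $$ h\Big[\jmath_T\big(\rho_T(w')\,w\big)\Big]=h\Big[\jmath_T\big(\rho_T(w)\,w'\big)\Big]. $$
   Context: Words in $e_0,e_1$; for $h\in R\langle\langle e_0,e_1\rangle\rangle$ write $h=\sum_w h[w]w$, with $h[\cdot]$ extended linearly and coefficientwise in $T$. The shuffle product $\sqcup\!\sqcup$ on $\mathbb{Q}\langle e_0,e_1\rangle$ is the usual one; $h$ is a Lie series if $h[\emptyset]=0$ and $h[u\,\sqcup\!\sqcup\, v]=0$ for all nonempty words $u,v$. $\mathcal{H}_{\ast}$ is the free algebra on letters $y_s$ ($s\geq1$), identified with $\mathbb{Q}\oplus\mathbb{Q}\langle e_0,e_1\rangle e_1$ via $y_{s_d}\cdots y_{s_1}\leftrightarrow e_0^{s_d-1}e_1\cdots e_0^{s_1-1}e_1$. For $v\in\mathbb{Q}\langle e_0,e_1\rangle[[T]]$, $\jmath_T(v)=\frac{1}{1-Te_0}e_1v=\sum_{l\geq0}T^le_0^le_1v$. The map $\rho_T:\mathcal{H}_{\ast}\to\mathcal{H}_{\ast}[[T]]$ is $\mathbb{Q}$-linear with $\rho_T(1)=1$ and $\rho_T(y_{s_d}\cdots y_{s_1})=(-1)^{s_1+\cdots+s_d}\sum_{l_1,\ldots,l_d\geq0}\prod_{i=1}^d\binom{l_i+s_i-1}{l_i}T^{l_i}\;y_{s_1+l_1}\cdots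 y_{s_d+l_d}$; equivalently $\rho_T=\mathrm{inv}\circ\imath_{\ast,T}$ where $\imath_{\ast,T}$ is the concatenation morphism $y_s\mapsto\sum_l(-T)^l\binom{l+s-1}{l}y_{s+l}$ and $\mathrm{inv}$ the concatenation anti-morphism $y_n\mapsto(-1)^ny_n$. Products are concatenation. -}

module Defs where

open import Level using (Level; _⊔_)
open import Data.Nat using (ℕ; zero; suc; _∸_)
open import Data.Nat.Combinatorics using (_C_)
open import Data.Integer using (+_)
open import Data.Rational using (ℚ; 0ℚ; 1ℚ; -_; _*_; _/_)
open import Data.Rational.Base using (+-*-rawRing)
open import Data.List using (List; []; _∷_; _++_; map; concatMap; reverse; zipWith; foldr; replicate; upTo; length)
open import Data.Product using (_×_; _,_)
open import Relation.Binary.PropositionalEquality using (_≡_)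
open import Relation.Nullary using (¬_)
open import Algebra.Bundles using (Ring)
open import Algebra.Morphism.Structures using (module RingMorphisms)

record QAlgebra (c ℓ : Level) : Set (Level.suc (c ⊔ ℓ)) where
  field
    ring  : Ring c ℓ
    ι     : ℚ → Ring.Carrier ring
    ι-hom : RingMorphisms.IsRingHomomorphism +-*-rawRing (Ring.rawRing ring) ι
  open Ring ring public

data Letter : Set where
  e₀ e₁ : Letter

Word : Set
Word = List Letter

-- an element of ℚ⟨e₀,e₁⟩ as a finite formal sum  Σ qᵢ wᵢ
Poly : Set
Poly = List (ℚ × Word)

-- shuffle product of two words, as the list of words (with multiplicity)
-- whose sum is  u ⧢ v
shuffle : Word → Word → List Word
shuffle [] v = v ∷ []
shuffle (a ∷ u) [] = (a ∷ u) ∷ []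
shuffle (a ∷ u) (b ∷ v) =
  map (a ∷_) (shuffle u (b ∷ v)) ++ map (b ∷_) (shuffle (a ∷ u) v)

-- ℋ_* : free algebra on letters y_s (s ≥ 1).  The letter  y[1+ k ]  is y_{k+1}.

data YLetter : Set where
  y[1+_] : ℕ → YLetter

-- a word y_{s_d} ⋯ y_{s_1} is the list  y_{s_d} ∷ ⋯ ∷ y_{s_1} ∷ []
YWord : Set
YWord = List YLetter

-- an element of ℋ_* as a finite formal sum  Σ qᵢ uᵢ
HPoly : Set
HPoly = List (ℚ × YWord)

-- identification  y_{s_d}⋯y_{s_1} ↦ e₀^{s_d-1}e₁ ⋯ e₀^{s_1-1}e₁
toE : YWord → Word
toE [] = []
toE (y[1+ k ] ∷ u) = replicate k e₀ ++ (e₁ ∷ toE u)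

toEPoly : HPoly → Poly
toEPoly = map (λ { (q , u) → q , toE u })

_·H_ : HPoly → HPoly → HPoly
p ·H p' = concatMap (λ { (q , u) → map (λ { (q' , u') → q * q' , u ++ u' }) p' }) p

compositions : ℕ → ℕ → List (List ℕ)
compositions zero    zero    = [] ∷ []
compositions (suc n) zero    = []
compositions n       (suc d) =
  concatMap (λ l → map (l ∷_) (compositions (n ∸ l) d)) (upTo (suc n))

negOnePow : ℕ → ℚ
negOnePow zero    = 1ℚ
negOnePow (suc m) = - negOnePow m

natℚ : ℕ → ℚ
natℚ m = + m / 1

prodℚ : List ℚ → ℚ
prodℚ = foldr _*_ 1ℚ

wt : YLetter → ℕ
wt y[1+ k ] = suc k

shiftLetter : YLetter → ℕ → ℚ × YLetter
shiftLetter y[1+ k ] l = negOnePow (suc k) * natℚ ((l Data.Nat.+ k) C l) , y[1+ k Data.Nat.+ l ]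

-- coefficient of T^n in ρ_T(y_{s_d}⋯y_{s_1})
--   = Σ_{l₁+⋯+l_d = n} (-1)^{s₁+⋯+s_d} ∏ binom(lᵢ+sᵢ-1,lᵢ) · y_{s₁+l₁}⋯y_{s_d+l_d}
ρword : ℕ → YWord → HPoly
ρword n u = map term (compositions n (length u))
  where
  rs = reverse u   -- y_{s₁} ∷ ⋯ ∷ y_{s_d} ∷ []
  term : List ℕ → ℚ × YWord
  term ls = prodℚ (zipWith (λ a l → Data.Product.proj₁ (shiftLetter a l)) rs ls)
          , zipWith (λ a l → Data.Product.proj₂ (shiftLetter a l)) rs ls

ρcoef : ℕ → HPoly → HPoly
ρcoef n p = concatMap (λ { (q , u) → map (λ { (q' , u') → q * q' , u' }) (ρword n u) }) p

-- ȷ_T(v) = Σ_l T^l e₀^l e₁ v ; for v = Σ_m T^m v_m the T^n coefficient is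
-- Σ_{l+m=n} e₀^l e₁ v_m

ȷcoef : (ℕ → Poly) → ℕ → Poly
ȷcoef v n = concatMap (λ l → map (λ { (q , u) → q , replicate l e₀ ++ (e₁ ∷ u) }) (v (n ∸ l)))
                      (upTo (suc n))

-- T^n coefficient of ȷ_T(ρ_T(w') w)
ȷρ : HPoly → HPoly → ℕ → Poly
ȷρ w' w = ȷcoef (λ m → toEPoly (ρcoef m w' ·H w))

module _ {c ℓ} (R : QAlgebra c ℓ) where
  open QAlgebra R using (Carrier; ι; _≈_; 0#) renaming (_+_ to _+R_; _*_ to _*R_)

  Series : Set c
  Series = Word → Carrier

  sumR : List Carrier → Carrier
  sumR = foldr _+R_ 0#

  coeff : Series → Poly → Carrier
  coeff h p = sumR (map (λ { (q , u) → ι q *R h u }) p)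

  IsLieSeries : Series → Set ℓ
  IsLieSeries h = (h [] ≈ 0#)
                × (∀ (u v : Word) → ¬ (u ≡ []) → ¬ (v ≡ []) → sumR (map h (shuffle u v)) ≈ 0#)

module Submission where

-- Write  g [ x ⧢e₀^ n ]  for a functional g evaluated on the shuffle of the
-- word x with the block e₀ⁿ.  The proof has two independent halves.
--
-- Series side.  Expanding ρ_T and ȷ_T letter by letter, the binomial weights
-- binom(l+s-1,l) of ρ_T are exactly the multiplicities in  e₀ᵃ ⧢ e₀ˡ , so for
-- words u, v ∈ ℋ_* the T^n coefficient of  g[ȷ_T(ρ_T(u) v)]  equals
--     (-1)^|u| (λ z → g(z e₁ v)) [ rev u ⧢e₀^ n ]          (kernel-⧢),
-- and by bilinearity (coeff-ȷρ) the theorem reduces to the symmetry of this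
-- kernel in u and v.
--
-- Lie side.  A Lie series kills  (x e₁ y) ⧢ e₀ ; splitting this shuffle at the
-- e₁ gives, for  Φ(a,b) = h[(U ⧢ e₀ᵃ) e₁ (V ⧢ e₀ᵇ)] , the recurrence
-- (a+1)Φ(a+1,b) + (b+1)Φ(a,b+1) = 0, hence Φ(0,n) = (-1)ⁿ Φ(n,0) after
-- dividing by n! (the only place where ℚ ⊆ R is used).  Combined with the
-- antipode identity  h(w) = (-1)^(|w|-1) h(rev w)  of Lie series this moves
-- e₀ⁿ across the e₁ and swaps the roles of u and v (e₁-exchange).

open import Defs
open import Level using (Level)
open import Data.Nat as N using (ℕ; zero; suc; _∸_)
import Data.Nat.Properties as NP
open import Data.Nat.Combinatorics using (_C_; nCn≡1; nC1≡n; nCk+nC[k+1]≡[n+1]C[k+1])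
open import Data.List using (List; []; _∷_; _++_; map; concatMap; reverse; replicate; length; zipWith; upTo; applyUpTo)
import Data.List.Properties as LP
open import Data.Product using (_,_; proj₁; proj₂)
import Data.Product as Prod
open import Relation.Nullary using (¬_)
open import Function using (_∘_)
open import Data.List.Relation.Unary.All using (All; []; _∷_)
import Data.List.Relation.Unary.All as All
import Data.List.Relation.Unary.All.Properties as AllP
import Relation.Binary.PropositionalEquality as P
open P using (_≡_)
import Data.Integer as Z
import Data.Integer.Properties as ZP
open import Data.Rational as Q using (ℚ; 1ℚ; mkℚ; toℚᵘ)
import Data.Rational.Properties as QP
import Data.Rational.Unnormalised as ℚᵘ
import Data.Rational.Unnormalised.Properties as ℚᵘP
open import Data.Nat.Coprimality using (gcd≡1⇒coprime; Coprime)
open import Data.Nat.GCD using (gcd-zeroʳ)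
open import Algebra.Morphism.Structures using (module RingMorphisms)
import Algebra.Bundles
open import Algebra.Properties.CommutativeSemigroup (Algebra.Bundles.CommutativeMonoid.commutativeSemigroup QP.*-1-commutativeMonoid) using () renaming (xy∙z≈xz∙y to ℚ-xy∙z≈xz∙y)

natℚ-suc : ∀ k → natℚ (suc k) ≡ 1ℚ Q.+ natℚ k
natℚ-suc k = QP.toℚᵘ-injective (ℚᵘP.≃-trans unnormalised (ℚᵘP.≃-sym (QP.toℚᵘ-homo-+ 1ℚ (natℚ k))))
  where
  coprime-1 : ∀ n → Coprime n 1
  coprime-1 n = gcd≡1⇒coprime (gcd-zeroʳ n)
  natℚ-mkℚ : ∀ n → natℚ n ≡ mkℚ (Z.+ n) 0 (coprime-1 n)
  natℚ-mkℚ n = QP.normalize-coprime (coprime-1 n)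
  unnormalised : toℚᵘ (natℚ (suc k)) ℚᵘ.≃ (toℚᵘ 1ℚ ℚᵘ.+ toℚᵘ (natℚ k))
  unnormalised rewrite natℚ-mkℚ (suc k) | natℚ-mkℚ k =
    ℚᵘ.*≡* (P.trans (ZP.*-identityʳ (Z.+ suc k))
                   (P.sym (P.trans (ZP.*-identityʳ _) (P.cong (λ z → Z.+ 1 Z.+ z) (ZP.*-identityʳ (Z.+ k))))))

HTerm : Set
HTerm = ℚ Prod.× YWord

infix 10 e₀^_
e₀^_ : ℕ → Word
e₀^ n = replicate n e₀

reverse-e₀^ : ∀ n → reverse (e₀^ n) ≡ e₀^ n
reverse-e₀^ zero    = P.refl
reverse-e₀^ (suc n) = P.trans (LP.unfold-reverse e₀ (e₀^ n)) (P.trans (P.cong (_++ e₀ ∷ []) (reverse-e₀^ n)) (e₀-commutes n))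
  where
  e₀-commutes : ∀ n → e₀^ n ++ e₀ ∷ [] ≡ e₀ ∷ e₀^ n
  e₀-commutes zero    = P.refl
  e₀-commutes (suc n) = P.cong (e₀ ∷_) (e₀-commutes n)

reverse-split : ∀ (x : Word) c y → reverse (x ++ c ∷ y) ≡ reverse y ++ c ∷ reverse x
reverse-split x c y = P.trans (LP.reverse-++ x (c ∷ y))
  (P.trans (P.cong (_++ reverse x) (LP.unfold-reverse c y)) (LP.++-assoc (reverse y) (c ∷ []) (reverse x)))

toE-++ : ∀ x y → toE (x ++ y) ≡ toE x ++ toE y
toE-++ []             y = P.refl
toE-++ (y[1+ k ] ∷ x) y =
  P.trans (P.cong (λ t → e₀^ k ++ e₁ ∷ t) (toE-++ x y)) (P.sym (LP.++-assoc (e₀^ k) (e₁ ∷ toE x) (toE y)))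

-- For rs = y_{s₁} ⋯ y_{s_d},  revE rs = e₁ e₀^(s₁-1) ⋯ e₁ e₀^(s_d-1) ,
-- which is  rev(toE(rev rs))  (reverse-toE).  It is the word that the shifts
-- of ρ_T(rev rs) are shuffled against (ρ-⧢).
revE : YWord → Word
revE []              = []
revE (y[1+ k ] ∷ rs) = e₁ ∷ e₀^ k ++ revE rs

reverse-toE : ∀ u → revE (reverse u) ≡ reverse (toE u)
reverse-toE []             = P.refl
reverse-toE (y[1+ k ] ∷ u) = begin
  revE (reverse (y[1+ k ] ∷ u))              ≡⟨ P.cong revE (LP.unfold-reverse y[1+ k ] u) ⟩
  revE (reverse u ++ y[1+ k ] ∷ [])          ≡⟨ revE-++ (reverse u) (y[1+ k ] ∷ []) ⟩
  revE (reverse u) ++ e₁ ∷ e₀^ k ++ []       ≡⟨ P.cong₂ (λ a b → a ++ e₁ ∷ b) (reverse-toE u) (LP.++-identityʳ (e₀^ k)) ⟩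
  reverse (toE u) ++ e₁ ∷ e₀^ k              ≡⟨ P.cong (λ t → reverse (toE u) ++ e₁ ∷ t) (P.sym (reverse-e₀^ k)) ⟩
  reverse (toE u) ++ e₁ ∷ reverse (e₀^ k)    ≡⟨ P.sym (reverse-split (e₀^ k) e₁ (toE u)) ⟩
  reverse (toE (y[1+ k ] ∷ u))               ∎
  where
  open P.≡-Reasoning
  revE-++ : ∀ x y → revE (x ++ y) ≡ revE x ++ revE y
  revE-++ []             y = P.refl
  revE-++ (y[1+ k ] ∷ x) y =
    P.cong (e₁ ∷_) (P.trans (P.cong (e₀^ k ++_) (revE-++ x y)) (P.sym (LP.++-assoc (e₀^ k) (revE x) (revE y))))

-- The term of the T^m coefficient of ρ_T(u) indexed by the shifts
-- ls = (l₁,…,l_d), written in terms of the reversed word rs = rev u: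
-- its coefficient  (-1)^(s₁+⋯+s_d) ∏ binom(lᵢ+sᵢ-1, lᵢ)  and its word  y_{s₁+l₁}⋯y_{s_d+l_d}.
shiftCoeff : YWord → List ℕ → ℚ
shiftCoeff rs ls = prodℚ (zipWith (λ a l → proj₁ (shiftLetter a l)) rs ls)

shiftWord : YWord → List ℕ → YWord
shiftWord rs ls = zipWith (λ a l → proj₂ (shiftLetter a l)) rs ls

signOf : YWord → ℚ
signOf []              = 1ℚ
signOf (y[1+ k ] ∷ rs) = negOnePow (suc k) Q.* signOf rs

compositions-suc : ∀ m d → compositions m (suc d) ≡ concatMap (λ l → map (l ∷_) (compositions (m ∸ l) d)) (upTo (suc m))
compositions-suc zero    d = P.refl
compositions-suc (suc m) d = P.refl

module Proof {c ℓ} (R : QAlgebra c ℓ) where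
  open QAlgebra R
  open import Relation.Binary.Reasoning.Setoid setoid
  open import Algebra.Properties.Ring ring using (-‿distribˡ-*)
  open import Algebra.Properties.AbelianGroup +-abelianGroup using (⁻¹-involutive; ⁻¹-∙-comm)
  open import Algebra.Properties.Group +-group using (ε⁻¹≈ε; inverseʳ-unique; inverseˡ-unique)
  open import Algebra.Properties.CommutativeSemigroup +-commutativeSemigroup using (interchange)
  open import Algebra.Properties.Semiring.Mult semiring using (_×_; ×-cong; ×-congʳ; ×-congˡ; ×-homo-1; ×-homo-+; ×-assocˡ; ×-comm-*)
  open import Algebra.Properties.CommutativeMonoid.Mult +-commutativeMonoid using (×-distrib-+)

  ≡⇒≈ : ∀ {x y} → x ≡ y → x ≈ y
  ≡⇒≈ P.refl = refl

  ×-zeroʳ : ∀ k → k × 0# ≈ 0#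
  ×-zeroʳ zero    = refl
  ×-zeroʳ (suc k) = trans (+-identityˡ _) (×-zeroʳ k)

  ∑ : {A : Set} → List A → (A → Carrier) → Carrier
  ∑ []       f = 0#
  ∑ (x ∷ xs) f = f x + ∑ xs f

  ∑-cong : {A : Set} (xs : List A) {f g : A → Carrier} → (∀ x → f x ≈ g x) → ∑ xs f ≈ ∑ xs g
  ∑-cong []       f≈g = refl
  ∑-cong (x ∷ xs) f≈g = +-cong (f≈g x) (∑-cong xs f≈g)

  ∑-++ : {A : Set} (xs ys : List A) (f : A → Carrier) → ∑ (xs ++ ys) f ≈ ∑ xs f + ∑ ys f
  ∑-++ []       ys f = sym (+-identityˡ _)
  ∑-++ (x ∷ xs) ys f = trans (+-congˡ (∑-++ xs ys f)) (sym (+-assoc _ _ _))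

  ∑-map : {A B : Set} (g : A → B) (xs : List A) (f : B → Carrier) → ∑ (map g xs) f ≡ ∑ xs (f ∘ g)
  ∑-map g []       f = P.refl
  ∑-map g (x ∷ xs) f = P.cong (f (g x) +_) (∑-map g xs f)

  ∑-concatMap : {A B : Set} (g : A → List B) (xs : List A) (f : B → Carrier) →
                ∑ (concatMap g xs) f ≈ ∑ xs (λ x → ∑ (g x) f)
  ∑-concatMap g []       f = refl
  ∑-concatMap g (x ∷ xs) f = trans (∑-++ (g x) (concatMap g xs) f) (+-congˡ (∑-concatMap g xs f))

  ∑-+ : {A : Set} (xs : List A) (f g : A → Carrier) → ∑ xs (λ x → f x + g x) ≈ ∑ xs f + ∑ xs g
  ∑-+ []       f g = sym (+-identityˡ _)
  ∑-+ (x ∷ xs) f g = trans (+-congˡ (∑-+ xs f g)) (interchange _ _ _ _)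

  ∑-0 : {A : Set} (xs : List A) → ∑ xs (λ _ → 0#) ≈ 0#
  ∑-0 []       = refl
  ∑-0 (x ∷ xs) = trans (+-identityˡ _) (∑-0 xs)

  ∑-*ˡ : {A : Set} (xs : List A) (a : Carrier) (f : A → Carrier) → a * ∑ xs f ≈ ∑ xs (λ x → a * f x)
  ∑-*ˡ []       a f = zeroʳ a
  ∑-*ˡ (x ∷ xs) a f = trans (distribˡ a _ _) (+-congˡ (∑-*ˡ xs a f))

  ∑-× : {A : Set} (xs : List A) (k : ℕ) (f : A → Carrier) → k × ∑ xs f ≈ ∑ xs (λ x → k × f x)
  ∑-× []       k f = ×-zeroʳ k
  ∑-× (x ∷ xs) k f = trans (×-distrib-+ (f x) (∑ xs f) k) (+-congˡ (∑-× xs k f))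

  ∑-swap : {A B : Set} (xs : List A) (ys : List B) (f : A → B → Carrier) →
           ∑ xs (λ x → ∑ ys (f x)) ≈ ∑ ys (λ y → ∑ xs (λ x → f x y))
  ∑-swap []       ys f = sym (∑-0 ys)
  ∑-swap (x ∷ xs) ys f = trans (+-congˡ (∑-swap xs ys f)) (sym (∑-+ ys (f x) (λ y → ∑ xs (λ x' → f x' y))))

  ∑< : ℕ → (ℕ → Carrier) → Carrier
  ∑< zero    F = 0#
  ∑< (suc n) F = F 0 + ∑< n (F ∘ suc)

  ∑-upTo : ∀ n (F : ℕ → Carrier) → ∑ (upTo n) F ≡ ∑< n F
  ∑-upTo n F = applyUpTo-sum (λ x → x) n F
    where
    applyUpTo-sum : ∀ (f : ℕ → ℕ) n (F : ℕ → Carrier) → ∑ (applyUpTo f n) F ≡ ∑< n (F ∘ f)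
    applyUpTo-sum f zero    F = P.refl
    applyUpTo-sum f (suc n) F = P.cong (F (f 0) +_) (applyUpTo-sum (f ∘ suc) n F)

  ∑<-cong : ∀ n {F G : ℕ → Carrier} → (∀ j → F j ≈ G j) → ∑< n F ≈ ∑< n G
  ∑<-cong zero    F≈G = refl
  ∑<-cong (suc n) F≈G = +-cong (F≈G 0) (∑<-cong n (F≈G ∘ suc))

  ∑<-cong-< : ∀ n {F G : ℕ → Carrier} → (∀ j → j N.< n → F j ≈ G j) → ∑< n F ≈ ∑< n G
  ∑<-cong-< zero    F≈G = refl
  ∑<-cong-< (suc n) F≈G = +-cong (F≈G 0 (N.s≤s N.z≤n)) (∑<-cong-< n (λ j j<n → F≈G (suc j) (N.s≤s j<n)))

  ∑<-+ : ∀ n (F G : ℕ → Carrier) → ∑< n (λ j → F j + G j) ≈ ∑< n F + ∑< n G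
  ∑<-+ zero    F G = sym (+-identityˡ _)
  ∑<-+ (suc n) F G = trans (+-congˡ (∑<-+ n (F ∘ suc) (G ∘ suc))) (interchange _ _ _ _)

  ∑<-*ˡ : ∀ n (a : Carrier) (F : ℕ → Carrier) → a * ∑< n F ≈ ∑< n (λ j → a * F j)
  ∑<-*ˡ zero    a F = zeroʳ a
  ∑<-*ˡ (suc n) a F = trans (distribˡ a _ _) (+-congˡ (∑<-*ˡ n a (F ∘ suc)))

  ∑<-snoc : ∀ n (F : ℕ → Carrier) → ∑< (suc n) F ≈ ∑< n F + F n
  ∑<-snoc zero    F = trans (+-identityʳ _) (sym (+-identityˡ _))
  ∑<-snoc (suc n) F = trans (+-congˡ (∑<-snoc n (F ∘ suc))) (sym (+-assoc _ _ _))

  ∑<-reverse : ∀ n (F : ℕ → Carrier) → ∑< (suc n) F ≈ ∑< (suc n) (λ j → F (n ∸ j))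
  ∑<-reverse zero    F = refl
  ∑<-reverse (suc n) F = begin
    ∑< (suc (suc n)) F                       ≈⟨ ∑<-snoc (suc n) F ⟩
    ∑< (suc n) F + F (suc n)                 ≈⟨ +-congʳ (∑<-reverse n F) ⟩
    ∑< (suc n) (λ j → F (n ∸ j)) + F (suc n) ≈⟨ +-comm _ _ ⟩
    F (suc n) + ∑< (suc n) (λ j → F (n ∸ j)) ∎

  ∑-∑< : {A : Set} (xs : List A) (n : ℕ) (F : ℕ → A → Carrier) →
         ∑ xs (λ x → ∑< n (λ j → F j x)) ≈ ∑< n (λ j → ∑ xs (F j))
  ∑-∑< xs zero    F = ∑-0 xs
  ∑-∑< xs (suc n) F = trans (∑-+ xs (F 0) (λ x → ∑< n (λ j → F (suc j) x))) (+-congˡ (∑-∑< xs n (F ∘ suc)))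

  negN : ℕ → Carrier → Carrier
  negN zero    x = x
  negN (suc n) x = - negN n x

  negN-cong : ∀ n {x y} → x ≈ y → negN n x ≈ negN n y
  negN-cong zero    x≈y = x≈y
  negN-cong (suc n) x≈y = -‿cong (negN-cong n x≈y)

  negN-+ : ∀ m n x → negN (m N.+ n) x ≡ negN m (negN n x)
  negN-+ zero    n x = P.refl
  negN-+ (suc m) n x = P.cong -_ (negN-+ m n x)

  negN-distrib-+ : ∀ n x y → negN n (x + y) ≈ negN n x + negN n y
  negN-distrib-+ zero    x y = refl
  negN-distrib-+ (suc n) x y = trans (-‿cong (negN-distrib-+ n x y)) (sym (⁻¹-∙-comm _ _))

  negN-0 : ∀ n → negN n 0# ≈ 0#
  negN-0 zero    = refl
  negN-0 (suc n) = trans (-‿cong (negN-0 n)) ε⁻¹≈ε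

  negN-× : ∀ n k x → negN n (k × x) ≈ k × negN n x
  negN-× zero    k x = refl
  negN-× (suc n) k x = trans (-‿cong (negN-× n k x)) (sym (×-neg k _))
    where
    ×-neg : ∀ k x → k × (- x) ≈ - (k × x)
    ×-neg zero    x = sym ε⁻¹≈ε
    ×-neg (suc k) x = trans (+-congˡ (×-neg k x)) (⁻¹-∙-comm _ _)

  negN-comm : ∀ m n x → negN m (negN n x) ≡ negN n (negN m x)
  negN-comm m n x = P.trans (P.sym (negN-+ m n x)) (P.trans (P.cong (λ k → negN k x) (NP.+-comm m n)) (negN-+ n m x))

  negN-involutive : ∀ n x → negN n (negN n x) ≈ x
  negN-involutive zero    x = refl
  negN-involutive (suc n) x = begin
    - negN n (- negN n x) ≈⟨ -‿cong (≡⇒≈ (negN-comm n 1 (negN n x))) ⟩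
    - (- negN n (negN n x)) ≈⟨ ⁻¹-involutive _ ⟩
    negN n (negN n x)       ≈⟨ negN-involutive n x ⟩
    x                       ∎

  ∑-negN : {A : Set} (xs : List A) (n : ℕ) (f : A → Carrier) → negN n (∑ xs f) ≈ ∑ xs (λ x → negN n (f x))
  ∑-negN []       n f = negN-0 n
  ∑-negN (x ∷ xs) n f = trans (negN-distrib-+ n _ _) (+-congˡ (∑-negN xs n f))

  module ιhom = RingMorphisms.IsRingHomomorphism ι-hom

  ι-cong : ∀ {p q} → p ≡ q → ι p ≈ ι q
  ι-cong P.refl = refl

  ι-* : ∀ p q x → ι (p Q.* q) * x ≈ ι p * (ι q * x)
  ι-* p q x = trans (*-congʳ (ιhom.*-homo p q)) (*-assoc _ _ _)

  ι-1 : ∀ x → ι 1ℚ * x ≈ x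
  ι-1 x = trans (*-congʳ ιhom.1#-homo) (*-identityˡ x)

  ι-natℚ : ∀ k x → ι (natℚ k) * x ≈ k × x
  ι-natℚ zero    x = trans (*-congʳ ιhom.0#-homo) (zeroˡ x)
  ι-natℚ (suc k) x = begin
    ι (natℚ (suc k)) * x      ≈⟨ *-congʳ (ι-cong (natℚ-suc k)) ⟩
    ι (1ℚ Q.+ natℚ k) * x     ≈⟨ *-congʳ (ιhom.+-homo 1ℚ (natℚ k)) ⟩
    (ι 1ℚ + ι (natℚ k)) * x   ≈⟨ distribʳ x _ _ ⟩
    ι 1ℚ * x + ι (natℚ k) * x ≈⟨ +-cong (ι-1 x) (ι-natℚ k x) ⟩
    x + k × x                 ∎

  ι-negOnePow : ∀ m x → ι (negOnePow m) * x ≈ negN m x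
  ι-negOnePow zero    x = ι-1 x
  ι-negOnePow (suc m) x = begin
    ι (Q.- negOnePow m) * x  ≈⟨ *-congʳ (ιhom.-‿homo (negOnePow m)) ⟩
    (- ι (negOnePow m)) * x  ≈⟨ sym (-‿distribˡ-* _ x) ⟩
    - (ι (negOnePow m) * x)  ≈⟨ -‿cong (ι-negOnePow m x) ⟩
    - negN m x               ∎

  -- R is a ℚ-algebra, so multiplication by a positive integer is injective.
  ×-cancel : ∀ k {x y} .{{_ : N.NonZero k}} → k × x ≈ k × y → x ≈ y
  ×-cancel k@(suc _) {x} {y} kx≈ky = begin
    x             ≈⟨ sym (inverse-× x) ⟩
    ι r * (k × x) ≈⟨ *-congˡ kx≈ky ⟩
    ι r * (k × y) ≈⟨ inverse-× y ⟩
    y             ∎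
    where
    q = natℚ k
    instance
      q≢0 : Q.NonZero q
      q≢0 = QP.pos⇒nonZero q {{QP.normalize-pos k 1}}
    r = Q.1/ q
    inverse-× : ∀ z → ι r * (k × z) ≈ z
    inverse-× z = begin
      ι r * (k × z)    ≈⟨ *-congˡ (sym (ι-natℚ k z)) ⟩
      ι r * (ι q * z)  ≈⟨ sym (ι-* r q z) ⟩
      ι (r Q.* q) * z  ≈⟨ *-congʳ (ι-cong (QP.*-inverseˡ q)) ⟩
      ι 1ℚ * z         ≈⟨ ι-1 z ⟩
      z                ∎

  infix 15 _[_⧢e₀^_]
  _[_⧢e₀^_] : (Word → Carrier) → Word → ℕ → Carrier
  g [ x ⧢e₀^ m ] = ∑ (shuffle x (e₀^ m)) g

  shuffle-[]ʳ : ∀ x → shuffle x [] ≡ x ∷ []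
  shuffle-[]ʳ []      = P.refl
  shuffle-[]ʳ (a ∷ x) = P.refl

  ⧢e₀^0 : ∀ g x → g [ x ⧢e₀^ 0 ] ≈ g x
  ⧢e₀^0 g x rewrite shuffle-[]ʳ x = +-identityʳ _

  []⧢e₀^ : ∀ g m → g [ [] ⧢e₀^ m ] ≈ g (e₀^ m)
  []⧢e₀^ g m = +-identityʳ _

  ∑-shuffle-cons : ∀ (g : Word → Carrier) c p a s →
                   ∑ (shuffle (c ∷ p) (a ∷ s)) g ≈ ∑ (shuffle p (a ∷ s)) (g ∘ (c ∷_)) + ∑ (shuffle (c ∷ p) s) (g ∘ (a ∷_))
  ∑-shuffle-cons g c p a s = trans (∑-++ (map (c ∷_) (shuffle p (a ∷ s))) _ g)
    (+-cong (≡⇒≈ (∑-map (c ∷_) (shuffle p (a ∷ s)) g)) (≡⇒≈ (∑-map (a ∷_) (shuffle (c ∷ p) s) g)))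

  ⧢e₀^-cons : ∀ g d x m → g [ d ∷ x ⧢e₀^ suc m ] ≈ (g ∘ (d ∷_)) [ x ⧢e₀^ suc m ] + (g ∘ (e₀ ∷_)) [ d ∷ x ⧢e₀^ m ]
  ⧢e₀^-cons g d x m = ∑-shuffle-cons g d x e₀ (e₀^ m)

  ⧢-cong : ∀ {f g} x m → (∀ z → f z ≈ g z) → f [ x ⧢e₀^ m ] ≈ g [ x ⧢e₀^ m ]
  ⧢-cong x m = ∑-cong (shuffle x (e₀^ m))

  ⧢-+ : ∀ f g x m → (λ z → f z + g z) [ x ⧢e₀^ m ] ≈ f [ x ⧢e₀^ m ] + g [ x ⧢e₀^ m ]
  ⧢-+ f g x m = ∑-+ (shuffle x (e₀^ m)) f g

  ⧢-0 : ∀ x m → (λ _ → 0#) [ x ⧢e₀^ m ] ≈ 0#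
  ⧢-0 x m = ∑-0 (shuffle x (e₀^ m))

  ⧢-× : ∀ k f x m → (λ z → k × f z) [ x ⧢e₀^ m ] ≈ k × f [ x ⧢e₀^ m ]
  ⧢-× k f x m = sym (∑-× (shuffle x (e₀^ m)) k f)

  ⧢-negN : ∀ k f x m → (λ z → negN k (f z)) [ x ⧢e₀^ m ] ≈ negN k (f [ x ⧢e₀^ m ])
  ⧢-negN k f x m = sym (∑-negN (shuffle x (e₀^ m)) k f)

  ⧢-swap : ∀ (g : Word → Word → Carrier) U a V b →
           (λ x → g x [ V ⧢e₀^ b ]) [ U ⧢e₀^ a ] ≈ (λ y → (λ x → g x y) [ U ⧢e₀^ a ]) [ V ⧢e₀^ b ]
  ⧢-swap g U a V b = ∑-swap (shuffle U (e₀^ a)) (shuffle V (e₀^ b)) g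

  ⧢-split : ∀ U (c : Letter) V (f : Word → Carrier) m →
            f [ U ++ c ∷ V ⧢e₀^ m ] ≈ ∑< (suc m) (λ a → (λ x → (λ y → f (x ++ c ∷ y)) [ V ⧢e₀^ m ∸ a ]) [ U ⧢e₀^ a ])
  ⧢-split U c V f zero = begin
    f [ U ++ c ∷ V ⧢e₀^ 0 ]                                         ≈⟨ ⧢e₀^0 f _ ⟩
    f (U ++ c ∷ V)                                                  ≈⟨ sym (⧢e₀^0 _ V) ⟩
    (λ y → f (U ++ c ∷ y)) [ V ⧢e₀^ 0 ]                             ≈⟨ sym (⧢e₀^0 _ U) ⟩
    (λ x → (λ y → f (x ++ c ∷ y)) [ V ⧢e₀^ 0 ]) [ U ⧢e₀^ 0 ]        ≈⟨ sym (+-identityʳ _) ⟩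
    ∑< 1 (λ a → (λ x → (λ y → f (x ++ c ∷ y)) [ V ⧢e₀^ 0 ∸ a ]) [ U ⧢e₀^ a ]) ∎
  ⧢-split [] c V f (suc m) = begin
    f [ c ∷ V ⧢e₀^ suc m ]                                           ≈⟨ ⧢e₀^-cons f c V m ⟩
    (f ∘ (c ∷_)) [ V ⧢e₀^ suc m ] + (f ∘ (e₀ ∷_)) [ c ∷ V ⧢e₀^ m ]  ≈⟨ +-cong (sym (⧢e₀^0 (G 0) [])) (⧢-split [] c V (f ∘ (e₀ ∷_)) m) ⟩
    G 0 [ [] ⧢e₀^ 0 ] + ∑< (suc m) (λ a → (λ x → (λ y → f (e₀ ∷ x ++ c ∷ y)) [ V ⧢e₀^ m ∸ a ]) [ [] ⧢e₀^ a ])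
      ≈⟨ +-congˡ (∑<-cong (suc m) (λ a → trans ([]⧢e₀^ (λ x → (λ y → f (e₀ ∷ x ++ c ∷ y)) [ V ⧢e₀^ m ∸ a ]) a)
                                                (sym ([]⧢e₀^ (G (suc a)) (suc a))))) ⟩
    ∑< (suc (suc m)) (λ a → G a [ [] ⧢e₀^ a ]) ∎
    where
    G : ℕ → Word → Carrier
    G a x = (λ y → f (x ++ c ∷ y)) [ V ⧢e₀^ suc m ∸ a ]
  ⧢-split (d ∷ U) c V f (suc m) = begin
    f [ d ∷ U ++ c ∷ V ⧢e₀^ suc m ]
      ≈⟨ ⧢e₀^-cons f d (U ++ c ∷ V) m ⟩
    (f ∘ (d ∷_)) [ U ++ c ∷ V ⧢e₀^ suc m ] + (f ∘ (e₀ ∷_)) [ d ∷ U ++ c ∷ V ⧢e₀^ m ]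
      ≈⟨ +-cong (⧢-split U c V (f ∘ (d ∷_)) (suc m)) (⧢-split (d ∷ U) c V (f ∘ (e₀ ∷_)) m) ⟩
    ∑< (suc (suc m)) (λ a → (G a ∘ (d ∷_)) [ U ⧢e₀^ a ]) + ∑< (suc m) (λ a → (G (suc a) ∘ (e₀ ∷_)) [ d ∷ U ⧢e₀^ a ])
      ≈⟨ +-assoc ((G 0 ∘ (d ∷_)) [ U ⧢e₀^ 0 ]) _ _ ⟩
    (G 0 ∘ (d ∷_)) [ U ⧢e₀^ 0 ] + (∑< (suc m) (λ a → (G (suc a) ∘ (d ∷_)) [ U ⧢e₀^ suc a ]) + ∑< (suc m) (λ a → (G (suc a) ∘ (e₀ ∷_)) [ d ∷ U ⧢e₀^ a ]))
      ≈⟨ +-cong (trans (⧢e₀^0 _ U) (sym (⧢e₀^0 (G 0) (d ∷ U)))) (sym (∑<-+ (suc m) (λ a → (G (suc a) ∘ (d ∷_)) [ U ⧢e₀^ suc a ]) (λ a → (G (suc a) ∘ (e₀ ∷_)) [ d ∷ U ⧢e₀^ a ]))) ⟩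
    G 0 [ d ∷ U ⧢e₀^ 0 ] + ∑< (suc m) (λ a → (G (suc a) ∘ (d ∷_)) [ U ⧢e₀^ suc a ] + (G (suc a) ∘ (e₀ ∷_)) [ d ∷ U ⧢e₀^ a ])
      ≈⟨ +-congˡ (∑<-cong (suc m) (λ a → sym (⧢e₀^-cons (G (suc a)) d U a))) ⟩
    ∑< (suc (suc m)) (λ a → G a [ d ∷ U ⧢e₀^ a ]) ∎
    where
    G : ℕ → Word → Carrier
    G a x = (λ y → f (x ++ c ∷ y)) [ V ⧢e₀^ suc m ∸ a ]

  ⧢-split-head : ∀ (c : Letter) V (f : Word → Carrier) m →
                 f [ c ∷ V ⧢e₀^ m ] ≈ ∑< (suc m) (λ a → (λ y → f (e₀^ a ++ c ∷ y)) [ V ⧢e₀^ m ∸ a ])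
  ⧢-split-head c V f m = trans (⧢-split [] c V f m) (∑<-cong (suc m) (λ a → []⧢e₀^ (λ x → (λ y → f (x ++ c ∷ y)) [ V ⧢e₀^ m ∸ a ]) a))

  -- e₀ᵃ ⧢ e₀ᵏ = binom(a+k, k) e₀^(a+k); these are the binomial weights of ρ_T.
  e₀^⧢e₀^ : ∀ a k g → g [ e₀^ a ⧢e₀^ k ] ≈ ((a N.+ k) C k) × g (e₀^ (a N.+ k))
  e₀^⧢e₀^ zero k g = begin
    g [ [] ⧢e₀^ k ]       ≈⟨ []⧢e₀^ g k ⟩
    g (e₀^ k)             ≈⟨ sym (×-homo-1 _) ⟩
    1 × g (e₀^ k)         ≈⟨ ×-congˡ (P.sym (nCn≡1 k)) ⟩
    (k C k) × g (e₀^ k)   ∎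
  e₀^⧢e₀^ (suc a) zero g = begin
    g [ e₀^ suc a ⧢e₀^ 0 ]                      ≈⟨ ⧢e₀^0 g _ ⟩
    g (e₀^ suc a)                               ≈⟨ sym (×-homo-1 _) ⟩
    1 × g (e₀^ suc a)                           ≈⟨ ≡⇒≈ (P.cong (λ t → 1 × g (e₀^ suc t)) (P.sym (NP.+-identityʳ a))) ⟩
    ((suc a N.+ 0) C 0) × g (e₀^ (suc a N.+ 0)) ∎
  e₀^⧢e₀^ (suc a) (suc k) g = begin
    g [ e₀^ suc a ⧢e₀^ suc k ]
      ≈⟨ ⧢e₀^-cons g e₀ (e₀^ a) k ⟩
    (g ∘ (e₀ ∷_)) [ e₀^ a ⧢e₀^ suc k ] + (g ∘ (e₀ ∷_)) [ e₀^ suc a ⧢e₀^ k ]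
      ≈⟨ +-cong (e₀^⧢e₀^ a (suc k) (g ∘ (e₀ ∷_))) (e₀^⧢e₀^ (suc a) k (g ∘ (e₀ ∷_))) ⟩
    ((a N.+ suc k) C suc k) × g (e₀ ∷ e₀^ (a N.+ suc k)) + (suc n C k) × X
      ≈⟨ +-congʳ (≡⇒≈ (P.cong (λ t → (t C suc k) × g (e₀ ∷ e₀^ t)) (NP.+-suc a k))) ⟩
    (suc n C suc k) × X + (suc n C k) × X     ≈⟨ +-comm _ _ ⟩
    (suc n C k) × X + (suc n C suc k) × X     ≈⟨ sym (×-homo-+ X (suc n C k) (suc n C suc k)) ⟩
    (suc n C k N.+ suc n C suc k) × X         ≈⟨ ×-congˡ (nCk+nC[k+1]≡[n+1]C[k+1] (suc n) k) ⟩
    (suc (suc n) C suc k) × X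
      ≈⟨ ≡⇒≈ (P.cong (λ t → (suc t C suc k) × g (e₀ ∷ e₀^ t)) (P.sym (NP.+-suc a k))) ⟩
    ((suc a N.+ suc k) C suc k) × g (e₀^ (suc a N.+ suc k)) ∎
    where
    n = a N.+ k
    X = g (e₀^ suc (suc n))

  e₀^⧢e₀ : ∀ j g → g [ e₀^ j ⧢e₀^ 1 ] ≈ suc j × g (e₀^ suc j)
  e₀^⧢e₀ j g = begin
    g [ e₀^ j ⧢e₀^ 1 ]               ≈⟨ e₀^⧢e₀^ j 1 g ⟩
    ((j N.+ 1) C 1) × g (e₀^ (j N.+ 1)) ≈⟨ ≡⇒≈ (P.cong (λ t → (t C 1) × g (e₀^ t)) (NP.+-comm j 1)) ⟩
    (suc j C 1) × g (e₀^ suc j)      ≈⟨ ×-congˡ (nC1≡n (suc j)) ⟩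
    suc j × g (e₀^ suc j)            ∎

  ∑<-weighted-pairs : ∀ N (A : ℕ → Carrier) →
                      ∑< (suc N) (λ j → suc (N ∸ j) × A j + suc j × A (suc j)) ≈ suc N × ∑< (suc (suc N)) A
  ∑<-weighted-pairs zero A = begin
    (1 × A 0 + 1 × A 1) + 0# ≈⟨ +-identityʳ _ ⟩
    1 × A 0 + 1 × A 1        ≈⟨ +-cong (×-homo-1 _) (×-homo-1 _) ⟩
    A 0 + A 1                ≈⟨ +-congˡ (sym (+-identityʳ _)) ⟩
    A 0 + (A 1 + 0#)         ≈⟨ sym (×-homo-1 _) ⟩
    1 × ∑< 2 A               ∎
  ∑<-weighted-pairs (suc M) A = begin
    (suc (suc M) × A 0 + 1 × A 1) + ∑< (suc M) (λ j → suc (M ∸ j) × B j + (B (suc j) + suc j × B (suc j)))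
      ≈⟨ +-congˡ (∑<-cong (suc M) (λ j → regroup (suc (M ∸ j) × B j) (suc j × B (suc j)) (B (suc j)))) ⟩
    (suc (suc M) × A 0 + 1 × A 1) + ∑< (suc M) (λ j → (suc (M ∸ j) × B j + suc j × B (suc j)) + B (suc j))
      ≈⟨ +-congˡ (∑<-+ (suc M) (λ j → suc (M ∸ j) × B j + suc j × B (suc j)) (B ∘ suc)) ⟩
    (suc (suc M) × A 0 + 1 × A 1) + (∑< (suc M) (λ j → suc (M ∸ j) × B j + suc j × B (suc j)) + Y)
      ≈⟨ +-congˡ (+-congʳ (∑<-weighted-pairs M B)) ⟩
    (suc (suc M) × A 0 + 1 × A 1) + (suc M × X + Y)
      ≈⟨ collect _ _ _ _ ⟩
    suc (suc M) × A 0 + ((A 1 + Y) + suc M × X)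
      ≈⟨ sym (×-distrib-+ (A 0) X (suc (suc M))) ⟩
    suc (suc M) × ∑< (suc (suc (suc M))) A ∎
    where
    B = A ∘ suc
    X = ∑< (suc (suc M)) B
    Y = ∑< (suc M) (B ∘ suc)
    regroup : ∀ a b c → a + (c + b) ≈ (a + b) + c
    regroup a b c = trans (+-congˡ (+-comm c b)) (sym (+-assoc a b c))
    collect : ∀ p q r y → (p + 1 × q) + (r + y) ≈ p + ((q + y) + r)
    collect p q r y = begin
      (p + 1 × q) + (r + y) ≈⟨ +-assoc _ _ _ ⟩
      p + (1 × q + (r + y)) ≈⟨ +-congˡ (+-cong (×-homo-1 q) (+-comm r y)) ⟩
      p + (q + (y + r))     ≈⟨ +-congˡ (sym (+-assoc q y r)) ⟩
      p + ((q + y) + r)     ∎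

  ⧢e₀^-⧢e₀ : ∀ U g n → (λ x → g [ x ⧢e₀^ 1 ]) [ U ⧢e₀^ n ] ≈ suc n × g [ U ⧢e₀^ suc n ]
  ⧢e₀^-⧢e₀ [] g n = begin
    (λ x → g [ x ⧢e₀^ 1 ]) [ [] ⧢e₀^ n ] ≈⟨ []⧢e₀^ (λ x → g [ x ⧢e₀^ 1 ]) n ⟩
    g [ e₀^ n ⧢e₀^ 1 ]                   ≈⟨ e₀^⧢e₀ n g ⟩
    suc n × g (e₀^ suc n)                ≈⟨ ×-congʳ (suc n) (sym ([]⧢e₀^ g (suc n))) ⟩
    suc n × g [ [] ⧢e₀^ suc n ]          ∎
  ⧢e₀^-⧢e₀ (c ∷ U) g n = begin
    (λ x → g [ x ⧢e₀^ 1 ]) [ c ∷ U ⧢e₀^ n ]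
      ≈⟨ ⧢-split-head c U (λ x → g [ x ⧢e₀^ 1 ]) n ⟩
    ∑< (suc n) (λ j → (λ y → g [ e₀^ j ++ c ∷ y ⧢e₀^ 1 ]) [ U ⧢e₀^ n ∸ j ])
      ≈⟨ ∑<-cong (suc n) (λ j → ⧢-cong U (n ∸ j) (shuffle-e₀ j)) ⟩
    ∑< (suc n) (λ j → (λ y → gj j [ y ⧢e₀^ 1 ] + suc j × gj (suc j) y) [ U ⧢e₀^ n ∸ j ])
      ≈⟨ ∑<-cong (suc n) (λ j → trans (⧢-+ (λ y → gj j [ y ⧢e₀^ 1 ]) (λ y → suc j × gj (suc j) y) U (n ∸ j))
                                       (+-cong (⧢e₀^-⧢e₀ U (gj j) (n ∸ j)) (⧢-× (suc j) (gj (suc j)) U (n ∸ j)))) ⟩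
    ∑< (suc n) (λ j → suc (n ∸ j) × gj j [ U ⧢e₀^ suc (n ∸ j) ] + suc j × A (suc j))
      ≈⟨ ∑<-cong-< (suc n) (λ j j≤n → +-cong (≡⇒≈ (P.cong (λ t → suc (n ∸ j) × gj j [ U ⧢e₀^ t ])
                                                         (P.sym (NP.+-∸-assoc 1 (NP.≤-pred j≤n)))))
                                                (refl {suc j × A (suc j)})) ⟩
    ∑< (suc n) (λ j → suc (n ∸ j) × A j + suc j × A (suc j))
      ≈⟨ ∑<-weighted-pairs n A ⟩
    suc n × ∑< (suc (suc n)) A
      ≈⟨ ×-congʳ (suc n) (sym (⧢-split-head c U g (suc n))) ⟩
    suc n × g [ c ∷ U ⧢e₀^ suc n ] ∎
    where
    gj : ℕ → Word → Carrier
    gj j z = g (e₀^ j ++ c ∷ z)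
    A : ℕ → Carrier
    A t = gj t [ U ⧢e₀^ suc n ∸ t ]
    shuffle-e₀ : ∀ j y → g [ e₀^ j ++ c ∷ y ⧢e₀^ 1 ] ≈ gj j [ y ⧢e₀^ 1 ] + suc j × gj (suc j) y
    shuffle-e₀ j y = begin
      g [ e₀^ j ++ c ∷ y ⧢e₀^ 1 ]
        ≈⟨ ⧢-split (e₀^ j) c y g 1 ⟩
      (λ x → (λ z → g (x ++ c ∷ z)) [ y ⧢e₀^ 1 ]) [ e₀^ j ⧢e₀^ 0 ] + ((λ x → (λ z → g (x ++ c ∷ z)) [ y ⧢e₀^ 0 ]) [ e₀^ j ⧢e₀^ 1 ] + 0#)
        ≈⟨ +-cong (⧢e₀^0 (λ x → (λ z → g (x ++ c ∷ z)) [ y ⧢e₀^ 1 ]) (e₀^ j))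
                  (trans (+-identityʳ _) (⧢-cong (e₀^ j) 1 (λ x → ⧢e₀^0 (λ z → g (x ++ c ∷ z)) y))) ⟩
      gj j [ y ⧢e₀^ 1 ] + (λ x → g (x ++ c ∷ y)) [ e₀^ j ⧢e₀^ 1 ]
        ≈⟨ +-congˡ (e₀^⧢e₀ j (λ x → g (x ++ c ∷ y))) ⟩
      gj j [ y ⧢e₀^ 1 ] + suc j × gj (suc j) y ∎

  ⧢-reverse : ∀ V g n → (g ∘ reverse) [ V ⧢e₀^ n ] ≈ g [ reverse V ⧢e₀^ n ]
  ⧢-reverse [] g n = trans ([]⧢e₀^ (g ∘ reverse) n) (trans (≡⇒≈ (P.cong g (reverse-e₀^ n))) (sym ([]⧢e₀^ g n)))
  ⧢-reverse (c ∷ V) g n = begin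
    (g ∘ reverse) [ c ∷ V ⧢e₀^ n ]
      ≈⟨ ⧢-split-head c V (g ∘ reverse) n ⟩
    ∑< (suc n) (λ a → (λ y → g (reverse (e₀^ a ++ c ∷ y))) [ V ⧢e₀^ n ∸ a ])
      ≈⟨ ∑<-cong (suc n) (λ a → ⧢-cong V (n ∸ a) (λ y → ≡⇒≈ (P.cong g
           (P.trans (reverse-split (e₀^ a) c y) (P.cong (λ t → reverse y ++ c ∷ t) (reverse-e₀^ a)))))) ⟩
    ∑< (suc n) (λ a → (λ y → g (reverse y ++ c ∷ e₀^ a)) [ V ⧢e₀^ n ∸ a ])
      ≈⟨ ∑<-cong (suc n) (λ a → ⧢-reverse V (λ z → g (z ++ c ∷ e₀^ a)) (n ∸ a)) ⟩
    ∑< (suc n) (λ a → (λ z → g (z ++ c ∷ e₀^ a)) [ reverse V ⧢e₀^ n ∸ a ])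
      ≈⟨ ∑<-reverse n (λ a → (λ z → g (z ++ c ∷ e₀^ a)) [ reverse V ⧢e₀^ n ∸ a ]) ⟩
    ∑< (suc n) (λ j → (λ z → g (z ++ c ∷ e₀^ (n ∸ j))) [ reverse V ⧢e₀^ n ∸ (n ∸ j) ])
      ≈⟨ ∑<-cong-< (suc n) (λ j j≤n → ≡⇒≈ (P.cong ((λ z → g (z ++ c ∷ e₀^ (n ∸ j))) [ reverse V ⧢e₀^_])
                                                 (NP.m∸[m∸n]≡n (NP.≤-pred j≤n)))) ⟩
    ∑< (suc n) (λ j → (λ z → g (z ++ c ∷ e₀^ (n ∸ j))) [ reverse V ⧢e₀^ j ])
      ≈⟨ ∑<-cong (suc n) (λ j → ⧢-cong (reverse V) j (λ x → sym ([]⧢e₀^ (λ y → g (x ++ c ∷ y)) (n ∸ j)))) ⟩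
    ∑< (suc n) (λ j → (λ x → (λ y → g (x ++ c ∷ y)) [ [] ⧢e₀^ n ∸ j ]) [ reverse V ⧢e₀^ j ])
      ≈⟨ sym (⧢-split (reverse V) c [] g n) ⟩
    g [ reverse V ++ c ∷ [] ⧢e₀^ n ]
      ≈⟨ ≡⇒≈ (P.cong (g [_⧢e₀^ n ]) (P.sym (LP.unfold-reverse c V))) ⟩
    g [ reverse (c ∷ V) ⧢e₀^ n ] ∎

  shuffle-length : ∀ u v → All (λ z → length z ≡ length u N.+ length v) (shuffle u v)
  shuffle-length []      v       = P.refl ∷ []
  shuffle-length (a ∷ u) []      = P.sym (NP.+-identityʳ (suc (length u))) ∷ []
  shuffle-length (a ∷ u) (b ∷ v) =
    AllP.++⁺ (AllP.map⁺ (All.map (P.cong suc) (shuffle-length u (b ∷ v))))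
            (AllP.map⁺ (All.map (λ e → P.trans (P.cong suc e) (P.sym (NP.+-suc (suc (length u)) (length v))))
                               (shuffle-length (a ∷ u) v)))

  ∑-length-sign : ∀ (zs : List Word) k (f : Word → Carrier) → All (λ z → length z ≡ k) zs →
                  ∑ zs (λ z → negN (length z) (f z)) ≈ negN k (∑ zs f)
  ∑-length-sign []       k f []         = sym (negN-0 k)
  ∑-length-sign (z ∷ zs) k f (e ∷ all-k) =
    trans (+-cong (≡⇒≈ (P.cong (λ t → negN t (f z)) e)) (∑-length-sign zs k f all-k)) (sym (negN-distrib-+ k _ _))

  ⧢-length-sign : ∀ f V n → (λ z → negN (length z) (f z)) [ V ⧢e₀^ n ] ≈ negN (length V N.+ n) (f [ V ⧢e₀^ n ])
  ⧢-length-sign f V n = ∑-length-sign (shuffle V (e₀^ n)) (length V N.+ n) f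
    (P.subst (λ t → All (λ z → length z ≡ length V N.+ t) (shuffle V (e₀^ n))) (LP.length-replicate n)
             (shuffle-length V (e₀^ n)))

  -- The series side: expanding ρ_T and ȷ_T into shuffles with e₀ⁿ.

  ι-sign : ∀ rs x → ι (signOf rs) * x ≈ negN (length (revE rs)) x
  ι-sign []              x = ι-1 x
  ι-sign (y[1+ k ] ∷ rs) x = begin
    ι (negOnePow (suc k) Q.* signOf rs) * x       ≈⟨ ι-* (negOnePow (suc k)) (signOf rs) x ⟩
    ι (negOnePow (suc k)) * (ι (signOf rs) * x)   ≈⟨ *-congˡ (ι-sign rs x) ⟩
    ι (negOnePow (suc k)) * negN (length (revE rs)) x ≈⟨ ι-negOnePow (suc k) _ ⟩
    negN (suc k) (negN (length (revE rs)) x)     ≈⟨ ≡⇒≈ (P.sym (negN-+ (suc k) (length (revE rs)) x)) ⟩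
    negN (suc k N.+ length (revE rs)) x          ≈⟨ ≡⇒≈ (P.cong (λ t → negN (suc t) x) (P.sym length-revE)) ⟩
    negN (length (revE (y[1+ k ] ∷ rs))) x       ∎
    where
    length-revE : length (e₀^ k ++ revE rs) ≡ k N.+ length (revE rs)
    length-revE = P.trans (LP.length-++ (e₀^ k)) (P.cong (N._+ length (revE rs)) (LP.length-replicate k))

  -- f summed over the T^m coefficient of ρ_T(rev rs), each term mapped to ℚ⟨e₀,e₁⟩.
  ρsum : (Word → Carrier) → YWord → ℕ → Carrier
  ρsum f rs m = ∑ (compositions m (length rs)) (λ ls → ι (shiftCoeff rs ls) * f (toE (shiftWord rs ls)))

  ∑-compositions-suc : ∀ m d (T : List ℕ → Carrier) →
                       ∑ (compositions m (suc d)) T ≈ ∑< (suc m) (λ l → ∑ (compositions (m ∸ l) d) (T ∘ (l ∷_)))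
  ∑-compositions-suc m d T = begin
    ∑ (compositions m (suc d)) T
      ≡⟨ P.cong (λ L → ∑ L T) (compositions-suc m d) ⟩
    ∑ (concatMap (λ l → map (l ∷_) (compositions (m ∸ l) d)) (upTo (suc m))) T
      ≈⟨ ∑-concatMap (λ l → map (l ∷_) (compositions (m ∸ l) d)) (upTo (suc m)) T ⟩
    ∑ (upTo (suc m)) (λ l → ∑ (map (l ∷_) (compositions (m ∸ l) d)) T)
      ≈⟨ ∑-cong (upTo (suc m)) (λ l → ≡⇒≈ (∑-map (l ∷_) (compositions (m ∸ l) d) T)) ⟩
    ∑ (upTo (suc m)) (λ l → ∑ (compositions (m ∸ l) d) (T ∘ (l ∷_)))
      ≡⟨ ∑-upTo (suc m) _ ⟩
    ∑< (suc m) (λ l → ∑ (compositions (m ∸ l) d) (T ∘ (l ∷_))) ∎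

  -- Only the shift l = m leaves the empty composition of m - l.
  ∑<-compositions-0 : ∀ m (F : ℕ → ℕ) (Y : ℕ → Carrier) →
                      ∑< (suc m) (λ l → F l × ∑ (compositions (m ∸ l) 0) (λ _ → Y l)) ≈ F m × Y m
  ∑<-compositions-0 zero    F Y = trans (+-identityʳ _) (×-congʳ (F 0) (+-identityʳ _))
  ∑<-compositions-0 (suc m) F Y =
    trans (+-congʳ (×-zeroʳ (F 0))) (trans (+-identityˡ _) (∑<-compositions-0 m (F ∘ suc) (Y ∘ suc)))

  ρsum-cons : ∀ f k rs m →
              ρsum f (y[1+ k ] ∷ rs) m
              ≈ ι (negOnePow (suc k)) * ∑< (suc m) (λ l → ((l N.+ k) C l) × ρsum (λ z → f (e₀^ (k N.+ l) ++ e₁ ∷ z)) rs (m ∸ l))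
  ρsum-cons f k rs m = begin
    ρsum f (y[1+ k ] ∷ rs) m
      ≈⟨ ∑-compositions-suc m (length rs) _ ⟩
    ∑< (suc m) (λ l → ∑ (comps l) (λ ls → ι ((σ Q.* natℚ (B l)) Q.* shiftCoeff rs ls) * f-at l (toE (shiftWord rs ls))))
      ≈⟨ ∑<-cong (suc m) (λ l → ∑-cong (comps l) (factor l)) ⟩
    ∑< (suc m) (λ l → ∑ (comps l) (λ ls → ι σ * (B l × (ι (shiftCoeff rs ls) * f-at l (toE (shiftWord rs ls))))))
      ≈⟨ ∑<-cong (suc m) (λ l → trans (sym (∑-*ˡ (comps l) (ι σ) _)) (*-congˡ (sym (∑-× (comps l) (B l) (λ ls → ι (shiftCoeff rs ls) * f-at l (toE (shiftWord rs ls))))))) ⟩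
    ∑< (suc m) (λ l → ι σ * (B l × ρsum (f-at l) rs (m ∸ l)))
      ≈⟨ sym (∑<-*ˡ (suc m) (ι σ) (λ l → B l × ρsum (f-at l) rs (m ∸ l))) ⟩
    ι σ * ∑< (suc m) (λ l → B l × ρsum (f-at l) rs (m ∸ l)) ∎
    where
    σ = negOnePow (suc k)
    B : ℕ → ℕ
    B l = (l N.+ k) C l
    comps : ℕ → List (List ℕ)
    comps l = compositions (m ∸ l) (length rs)
    f-at : ℕ → Word → Carrier
    f-at l z = f (e₀^ (k N.+ l) ++ e₁ ∷ z)
    factor : ∀ l ls → ι ((σ Q.* natℚ (B l)) Q.* shiftCoeff rs ls) * f-at l (toE (shiftWord rs ls))
                      ≈ ι σ * (B l × (ι (shiftCoeff rs ls) * f-at l (toE (shiftWord rs ls))))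
    factor l ls = trans (ι-* (σ Q.* natℚ (B l)) (shiftCoeff rs ls) _)
                        (trans (ι-* σ (natℚ (B l)) _) (*-congˡ (ι-natℚ (B l) _)))

  -- The core computation: the binomial weights of ρ_T are shuffle
  -- multiplicities (e₀^⧢e₀^), so summing over all shifts produces a shuffle
  -- with e₀ᵐ.  The leading block e₀ᵃ makes the induction on rs go through.
  ρ-⧢ : ∀ rs f m a →
        ∑< (suc m) (λ l → ((l N.+ a) C l) × ρsum (λ z → f (e₀^ (a N.+ l) ++ e₁ ∷ z)) rs (m ∸ l))
        ≈ ι (signOf rs) * (λ z → f (z ++ e₁ ∷ [])) [ e₀^ a ++ revE rs ⧢e₀^ m ]
  ρ-⧢ [] f m a = begin
    ∑< (suc m) (λ l → ((l N.+ a) C l) × ∑ (compositions (m ∸ l) 0) (λ _ → ι 1ℚ * f (e₀^ (a N.+ l) ++ e₁ ∷ [])))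
      ≈⟨ ∑<-compositions-0 m (λ l → (l N.+ a) C l) (λ l → ι 1ℚ * f (e₀^ (a N.+ l) ++ e₁ ∷ [])) ⟩
    ((m N.+ a) C m) × (ι 1ℚ * f (e₀^ (a N.+ m) ++ e₁ ∷ []))
      ≈⟨ ×-cong (P.cong (_C m) (NP.+-comm m a)) (ι-1 _) ⟩
    ((a N.+ m) C m) × f (e₀^ (a N.+ m) ++ e₁ ∷ [])
      ≈⟨ sym (e₀^⧢e₀^ a m F) ⟩
    F [ e₀^ a ⧢e₀^ m ]
      ≡⟨ P.cong (F [_⧢e₀^ m ]) (P.sym (LP.++-identityʳ (e₀^ a))) ⟩
    F [ e₀^ a ++ [] ⧢e₀^ m ]
      ≈⟨ sym (ι-1 _) ⟩
    ι 1ℚ * F [ e₀^ a ++ [] ⧢e₀^ m ] ∎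
    where
    F : Word → Carrier
    F z = f (z ++ e₁ ∷ [])
  ρ-⧢ (y[1+ k ] ∷ rs) f m a = begin
    ∑< (suc m) (λ l → B l × ρsum (f-at l) (y[1+ k ] ∷ rs) (m ∸ l))
      ≈⟨ ∑<-cong (suc m) (λ l → ×-congʳ (B l) (trans (ρsum-cons (f-at l) k rs (m ∸ l)) (*-congˡ (ρ-⧢ rs (f-at l) (m ∸ l) k)))) ⟩
    ∑< (suc m) (λ l → B l × (ι σ * (ι (signOf rs) * F' l [ V ⧢e₀^ m ∸ l ])))
      ≈⟨ ∑<-cong (suc m) (λ l → scalars-commute (B l) (F' l [ V ⧢e₀^ m ∸ l ])) ⟩
    ∑< (suc m) (λ l → ι (σ Q.* signOf rs) * (B l × F' l [ V ⧢e₀^ m ∸ l ]))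
      ≈⟨ sym (∑<-*ˡ (suc m) (ι (σ Q.* signOf rs)) (λ l → B l × F' l [ V ⧢e₀^ m ∸ l ])) ⟩
    ι (σ Q.* signOf rs) * ∑< (suc m) (λ l → B l × F' l [ V ⧢e₀^ m ∸ l ])
      ≈⟨ *-congˡ (∑<-cong (suc m) (λ j → sym (weight-as-⧢ j))) ⟩
    ι (σ Q.* signOf rs) * ∑< (suc m) (λ j → (λ x → (λ y → F (x ++ e₁ ∷ y)) [ V ⧢e₀^ m ∸ j ]) [ e₀^ a ⧢e₀^ j ])
      ≈⟨ *-congˡ (sym (⧢-split (e₀^ a) e₁ V F m)) ⟩
    ι (σ Q.* signOf rs) * F [ e₀^ a ++ e₁ ∷ V ⧢e₀^ m ] ∎
    where
    σ = negOnePow (suc k)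
    V = e₀^ k ++ revE rs
    B : ℕ → ℕ
    B l = (l N.+ a) C l
    F : Word → Carrier
    F z = f (z ++ e₁ ∷ [])
    f-at : ℕ → Word → Carrier
    f-at l z = f (e₀^ (a N.+ l) ++ e₁ ∷ z)
    F' : ℕ → Word → Carrier
    F' l z = f (e₀^ (a N.+ l) ++ e₁ ∷ (z ++ e₁ ∷ []))
    scalars-commute : ∀ b X → b × (ι σ * (ι (signOf rs) * X)) ≈ ι (σ Q.* signOf rs) * (b × X)
    scalars-commute b X = begin
      b × (ι σ * (ι (signOf rs) * X)) ≈⟨ sym (×-comm-* b (ι σ) _) ⟩
      ι σ * (b × (ι (signOf rs) * X)) ≈⟨ *-congˡ (sym (×-comm-* b (ι (signOf rs)) X)) ⟩
      ι σ * (ι (signOf rs) * (b × X)) ≈⟨ sym (ι-* σ (signOf rs) _) ⟩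
      ι (σ Q.* signOf rs) * (b × X)   ∎
    weight-as-⧢ : ∀ j → (λ x → (λ y → F (x ++ e₁ ∷ y)) [ V ⧢e₀^ m ∸ j ]) [ e₀^ a ⧢e₀^ j ] ≈ B j × F' j [ V ⧢e₀^ m ∸ j ]
    weight-as-⧢ j = trans (e₀^⧢e₀^ a j _)
      (×-cong (P.cong (_C j) (NP.+-comm a j))
              (⧢-cong V (m ∸ j) (λ y → ≡⇒≈ (P.cong f (LP.++-assoc (e₀^ (a N.+ j)) (e₁ ∷ y) (e₁ ∷ []))))))

  -- The T^n coefficient of  g[ȷ_T(ρ_T(u) v)]  for words u, v of ℋ_*.
  kernel : (Word → Carrier) → YWord → YWord → ℕ → Carrier
  kernel g u v n = ∑ (upTo (suc n)) (λ l → ∑ (ρword (n ∸ l) u) (λ z → ι (proj₁ z) * g (e₀^ l ++ e₁ ∷ toE (proj₂ z ++ v))))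

  kernel-⧢ : ∀ g u v n → kernel g u v n ≈ negN (length (toE u)) ((λ z → g (z ++ e₁ ∷ toE v)) [ reverse (toE u) ⧢e₀^ n ])
  kernel-⧢ g u v n = begin
    kernel g u v n
      ≡⟨ ∑-upTo (suc n) _ ⟩
    ∑< (suc n) (λ l → ∑ (ρword (n ∸ l) u) (λ z → ι (proj₁ z) * g (e₀^ l ++ e₁ ∷ toE (proj₂ z ++ v))))
      ≈⟨ ∑<-cong (suc n) as-ρsum ⟩
    ∑< (suc n) (λ l → ((l N.+ 0) C l) × ρsum (λ z → f (e₀^ l ++ e₁ ∷ z)) rs (n ∸ l))
      ≈⟨ ρ-⧢ rs f n 0 ⟩
    ι (signOf rs) * (λ z → f (z ++ e₁ ∷ [])) [ revE rs ⧢e₀^ n ]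
      ≈⟨ ι-sign rs _ ⟩
    negN (length (revE rs)) ((λ z → f (z ++ e₁ ∷ [])) [ revE rs ⧢e₀^ n ])
      ≈⟨ negN-cong (length (revE rs)) (⧢-cong (revE rs) n (λ z → ≡⇒≈ (P.cong g (LP.++-assoc z (e₁ ∷ []) (toE v))))) ⟩
    negN (length (revE rs)) ((λ z → g (z ++ e₁ ∷ toE v)) [ revE rs ⧢e₀^ n ])
      ≡⟨ P.cong (λ t → negN (length t) ((λ z → g (z ++ e₁ ∷ toE v)) [ t ⧢e₀^ n ])) (reverse-toE u) ⟩
    negN (length (reverse (toE u))) ((λ z → g (z ++ e₁ ∷ toE v)) [ reverse (toE u) ⧢e₀^ n ])
      ≡⟨ P.cong (λ t → negN t ((λ z → g (z ++ e₁ ∷ toE v)) [ reverse (toE u) ⧢e₀^ n ])) (LP.length-reverse (toE u)) ⟩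
    negN (length (toE u)) ((λ z → g (z ++ e₁ ∷ toE v)) [ reverse (toE u) ⧢e₀^ n ]) ∎
    where
    rs = reverse u
    f : Word → Carrier
    f z = g (z ++ toE v)
    as-ρsum : ∀ l → ∑ (ρword (n ∸ l) u) (λ z → ι (proj₁ z) * g (e₀^ l ++ e₁ ∷ toE (proj₂ z ++ v)))
                    ≈ ((l N.+ 0) C l) × ρsum (λ z → f (e₀^ l ++ e₁ ∷ z)) rs (n ∸ l)
    as-ρsum l = begin
      ∑ (ρword (n ∸ l) u) (λ z → ι (proj₁ z) * g (e₀^ l ++ e₁ ∷ toE (proj₂ z ++ v)))
        ≡⟨ ∑-map _ (compositions (n ∸ l) (length u)) _ ⟩
      ∑ (compositions (n ∸ l) (length u)) (λ ls → ι (shiftCoeff rs ls) * g (e₀^ l ++ e₁ ∷ toE (shiftWord rs ls ++ v)))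
        ≈⟨ ∑-cong (compositions (n ∸ l) (length u)) (λ ls → *-congˡ (≡⇒≈ (P.cong g (toE-split ls)))) ⟩
      ∑ (compositions (n ∸ l) (length u)) (λ ls → ι (shiftCoeff rs ls) * f (e₀^ l ++ e₁ ∷ toE (shiftWord rs ls)))
        ≡⟨ P.cong (λ d → ∑ (compositions (n ∸ l) d) (λ ls → ι (shiftCoeff rs ls) * f (e₀^ l ++ e₁ ∷ toE (shiftWord rs ls))))
                  (P.sym (LP.length-reverse u)) ⟩
      ρsum (λ z → f (e₀^ l ++ e₁ ∷ z)) rs (n ∸ l)
        ≈⟨ sym (×-homo-1 _) ⟩
      1 × ρsum (λ z → f (e₀^ l ++ e₁ ∷ z)) rs (n ∸ l)
        ≈⟨ ×-congˡ (P.sym (P.trans (P.cong (_C l) (NP.+-identityʳ l)) (nCn≡1 l))) ⟩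
      ((l N.+ 0) C l) × ρsum (λ z → f (e₀^ l ++ e₁ ∷ z)) rs (n ∸ l) ∎
      where
      toE-split : ∀ ls → e₀^ l ++ e₁ ∷ toE (shiftWord rs ls ++ v) ≡ (e₀^ l ++ e₁ ∷ toE (shiftWord rs ls)) ++ toE v
      toE-split ls = P.trans (P.cong (λ t → e₀^ l ++ e₁ ∷ t) (toE-++ (shiftWord rs ls) v))
                             (P.sym (LP.++-assoc (e₀^ l) (e₁ ∷ toE (shiftWord rs ls)) (toE v)))

  coeff-∑ : ∀ g p → coeff R g p ≡ ∑ p (λ x → ι (proj₁ x) * g (proj₂ x))
  coeff-∑ g []      = P.refl
  coeff-∑ g (x ∷ p) = P.cong (ι (proj₁ x) * g (proj₂ x) +_) (coeff-∑ g p)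

  coeff-ȷ : ∀ g (v : ℕ → Poly) n →
            coeff R g (ȷcoef v n) ≈ ∑ (upTo (suc n)) (λ l → ∑ (v (n ∸ l)) (λ x → ι (proj₁ x) * g (e₀^ l ++ e₁ ∷ proj₂ x)))
  coeff-ȷ g v n = begin
    coeff R g (ȷcoef v n)
      ≡⟨ coeff-∑ g (ȷcoef v n) ⟩
    ∑ (ȷcoef v n) (λ x → ι (proj₁ x) * g (proj₂ x))
      ≈⟨ ∑-concatMap (λ l → map (prefix l) (v (n ∸ l))) (upTo (suc n)) _ ⟩
    ∑ (upTo (suc n)) (λ l → ∑ (map (prefix l) (v (n ∸ l))) (λ x → ι (proj₁ x) * g (proj₂ x)))
      ≈⟨ ∑-cong (upTo (suc n)) (λ l → ≡⇒≈ (∑-map (prefix l) (v (n ∸ l)) _)) ⟩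
    ∑ (upTo (suc n)) (λ l → ∑ (v (n ∸ l)) (λ x → ι (proj₁ x) * g (e₀^ l ++ e₁ ∷ proj₂ x))) ∎
    where
    prefix : ℕ → ℚ Prod.× Word → ℚ Prod.× Word
    prefix l x = proj₁ x , e₀^ l ++ e₁ ∷ proj₂ x

  ∑-toE-·H : ∀ (g : Word → Carrier) p p' →
             ∑ (toEPoly (p ·H p')) (λ x → ι (proj₁ x) * g (proj₂ x))
             ≈ ∑ p (λ x → ∑ p' (λ y → ι (proj₁ x Q.* proj₁ y) * g (toE (proj₂ x ++ proj₂ y))))
  ∑-toE-·H g p p' = begin
    ∑ (toEPoly (p ·H p')) (λ x → ι (proj₁ x) * g (proj₂ x))
      ≡⟨ ∑-map _ (p ·H p') _ ⟩
    ∑ (p ·H p') (λ x → ι (proj₁ x) * g (toE (proj₂ x)))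
      ≈⟨ ∑-concatMap (λ x → map (concat-with x) p') p _ ⟩
    ∑ p (λ x → ∑ (map (concat-with x) p') (λ x → ι (proj₁ x) * g (toE (proj₂ x))))
      ≈⟨ ∑-cong p (λ x → ≡⇒≈ (∑-map (concat-with x) p' _)) ⟩
    ∑ p (λ x → ∑ p' (λ y → ι (proj₁ x Q.* proj₁ y) * g (toE (proj₂ x ++ proj₂ y)))) ∎
    where
    concat-with : HTerm → HTerm → HTerm
    concat-with x y = proj₁ x Q.* proj₁ y , proj₂ x ++ proj₂ y

  ∑-ρcoef : ∀ m p (F : HTerm → Carrier) →
            ∑ (ρcoef m p) F ≈ ∑ p (λ x → ∑ (ρword m (proj₂ x)) (λ z → F (proj₁ x Q.* proj₁ z , proj₂ z)))
  ∑-ρcoef m p F = trans (∑-concatMap (λ x → map (scale x) (ρword m (proj₂ x))) p F)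
                        (∑-cong p (λ x → ≡⇒≈ (∑-map (scale x) (ρword m (proj₂ x)) F)))
    where
    scale : HTerm → HTerm → HTerm
    scale x z = proj₁ x Q.* proj₁ z , proj₂ z

  coeff-ȷρ : ∀ g w' w n →
             coeff R g (ȷρ w' w n) ≈ ∑ w' (λ x → ∑ w (λ y → ι (proj₁ x Q.* proj₁ y) * kernel g (proj₂ x) (proj₂ y) n))
  coeff-ȷρ g w' w n = begin
    coeff R g (ȷρ w' w n)
      ≈⟨ coeff-ȷ g (λ m → toEPoly (ρcoef m w' ·H w)) n ⟩
    ∑ (upTo (suc n)) (λ l → ∑ (toEPoly (ρcoef (n ∸ l) w' ·H w)) (λ x → ι (proj₁ x) * g (e₀^ l ++ e₁ ∷ proj₂ x)))
      ≈⟨ ∑-cong (upTo (suc n)) (λ l → ∑-toE-·H (λ u → g (e₀^ l ++ e₁ ∷ u)) (ρcoef (n ∸ l) w') w) ⟩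
    ∑ (upTo (suc n)) (λ l → ∑ (ρcoef (n ∸ l) w') (λ z → ∑ w (λ y → ι (proj₁ z Q.* proj₁ y) * g (e₀^ l ++ e₁ ∷ toE (proj₂ z ++ proj₂ y)))))
      ≈⟨ ∑-cong (upTo (suc n)) (λ l → ∑-ρcoef (n ∸ l) w' _) ⟩
    ∑ (upTo (suc n)) (λ l → ∑ w' (λ x → ∑ (ρword (n ∸ l) (proj₂ x)) (λ z → ∑ w (λ y → T l x z y))))
      ≈⟨ reorder ⟩
    ∑ w' (λ x → ∑ w (λ y → ∑ (upTo (suc n)) (λ l → ∑ (ρword (n ∸ l) (proj₂ x)) (λ z → T l x z y))))
      ≈⟨ ∑-cong w' (λ x → ∑-cong w (λ y → pull-scalar x y)) ⟩
    ∑ w' (λ x → ∑ w (λ y → ι (proj₁ x Q.* proj₁ y) * kernel g (proj₂ x) (proj₂ y) n)) ∎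
    where
    T : ℕ → HTerm → HTerm → HTerm → Carrier
    T l x z y = ι ((proj₁ x Q.* proj₁ z) Q.* proj₁ y) * g (e₀^ l ++ e₁ ∷ toE (proj₂ z ++ proj₂ y))
    reorder : ∑ (upTo (suc n)) (λ l → ∑ w' (λ x → ∑ (ρword (n ∸ l) (proj₂ x)) (λ z → ∑ w (λ y → T l x z y))))
              ≈ ∑ w' (λ x → ∑ w (λ y → ∑ (upTo (suc n)) (λ l → ∑ (ρword (n ∸ l) (proj₂ x)) (λ z → T l x z y))))
    reorder = begin
      ∑ (upTo (suc n)) (λ l → ∑ w' (λ x → ∑ (ρword (n ∸ l) (proj₂ x)) (λ z → ∑ w (λ y → T l x z y))))
        ≈⟨ ∑-swap (upTo (suc n)) w' _ ⟩
      ∑ w' (λ x → ∑ (upTo (suc n)) (λ l → ∑ (ρword (n ∸ l) (proj₂ x)) (λ z → ∑ w (λ y → T l x z y))))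
        ≈⟨ ∑-cong w' (λ x → ∑-cong (upTo (suc n)) (λ l → ∑-swap (ρword (n ∸ l) (proj₂ x)) w (T l x))) ⟩
      ∑ w' (λ x → ∑ (upTo (suc n)) (λ l → ∑ w (λ y → ∑ (ρword (n ∸ l) (proj₂ x)) (λ z → T l x z y))))
        ≈⟨ ∑-cong w' (λ x → ∑-swap (upTo (suc n)) w _) ⟩
      ∑ w' (λ x → ∑ w (λ y → ∑ (upTo (suc n)) (λ l → ∑ (ρword (n ∸ l) (proj₂ x)) (λ z → T l x z y)))) ∎
    pull-scalar : ∀ x y → ∑ (upTo (suc n)) (λ l → ∑ (ρword (n ∸ l) (proj₂ x)) (λ z → T l x z y))
                          ≈ ι (proj₁ x Q.* proj₁ y) * kernel g (proj₂ x) (proj₂ y) n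
    pull-scalar x y = begin
      ∑ (upTo (suc n)) (λ l → ∑ (ρword (n ∸ l) (proj₂ x)) (λ z → T l x z y))
        ≈⟨ ∑-cong (upTo (suc n)) (λ l → ∑-cong (ρword (n ∸ l) (proj₂ x)) (λ z → regroup (proj₁ z) _)) ⟩
      ∑ (upTo (suc n)) (λ l → ∑ (ρword (n ∸ l) (proj₂ x)) (λ z → scalar * K l z))
        ≈⟨ ∑-cong (upTo (suc n)) (λ l → sym (∑-*ˡ (ρword (n ∸ l) (proj₂ x)) scalar (K l))) ⟩
      ∑ (upTo (suc n)) (λ l → scalar * ∑ (ρword (n ∸ l) (proj₂ x)) (K l))
        ≈⟨ sym (∑-*ˡ (upTo (suc n)) scalar _) ⟩
      scalar * kernel g (proj₂ x) (proj₂ y) n ∎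
      where
      scalar = ι (proj₁ x Q.* proj₁ y)
      K : ℕ → HTerm → Carrier
      K l z = ι (proj₁ z) * g (e₀^ l ++ e₁ ∷ toE (proj₂ z ++ proj₂ y))
      regroup : ∀ q X → ι ((proj₁ x Q.* q) Q.* proj₁ y) * X ≈ scalar * (ι q * X)
      regroup q X = trans (*-congʳ (ι-cong (ℚ-xy∙z≈xz∙y (proj₁ x) q (proj₁ y)))) (ι-* (proj₁ x Q.* proj₁ y) q X)

  -- The Lie side.

  sumR-∑ : ∀ (g : Word → Carrier) zs → sumR R (map g zs) ≡ ∑ zs g
  sumR-∑ g []       = P.refl
  sumR-∑ g (z ∷ zs) = P.cong (g z +_) (sumR-∑ g zs)

  module LieSeries (h : Series R) (lie : IsLieSeries R h) where

    lie-⧢ : ∀ u v → ¬ u ≡ [] → ¬ v ≡ [] → ∑ (shuffle u v) h ≈ 0#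
    lie-⧢ u v u≢[] v≢[] = trans (≡⇒≈ (P.sym (sumR-∑ h (shuffle u v)))) (proj₂ lie u v u≢[] v≢[])

    lie-reflection : ∀ c p s → ∑ (shuffle p s) (h ∘ (c ∷_)) ≈ negN (length s) (h (reverse s ++ c ∷ p))
    lie-reflection c p [] rewrite shuffle-[]ʳ p = +-identityʳ _
    lie-reflection c p (a ∷ s) = begin
      ∑ (shuffle p (a ∷ s)) (h ∘ (c ∷_))             ≈⟨ inverseˡ-unique _ _ split-vanishes ⟩
      - ∑ (shuffle (c ∷ p) s) (h ∘ (a ∷_))           ≈⟨ -‿cong (lie-reflection a (c ∷ p) s) ⟩
      - negN (length s) (h (reverse s ++ a ∷ c ∷ p)) ≈⟨ ≡⇒≈ (P.cong (λ w → - negN (length s) (h w)) (P.sym reverse-∷)) ⟩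
      negN (length (a ∷ s)) (h (reverse (a ∷ s) ++ c ∷ p)) ∎
      where
      split-vanishes : ∑ (shuffle p (a ∷ s)) (h ∘ (c ∷_)) + ∑ (shuffle (c ∷ p) s) (h ∘ (a ∷_)) ≈ 0#
      split-vanishes = trans (sym (∑-shuffle-cons h c p a s)) (lie-⧢ (c ∷ p) (a ∷ s) (λ ()) (λ ()))
      reverse-∷ : reverse (a ∷ s) ++ c ∷ p ≡ reverse s ++ a ∷ c ∷ p
      reverse-∷ = P.trans (P.cong (_++ c ∷ p) (LP.unfold-reverse a s)) (LP.++-assoc (reverse s) (a ∷ []) (c ∷ p))

    antipode : ∀ a s → h (a ∷ s) ≈ negN (length s) (h (reverse (a ∷ s)))
    antipode a s = begin
      h (a ∷ s)                                 ≈⟨ sym (+-identityʳ _) ⟩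
      ∑ (shuffle [] s) (h ∘ (a ∷_))             ≈⟨ lie-reflection a [] s ⟩
      negN (length s) (h (reverse s ++ a ∷ [])) ≈⟨ negN-cong (length s) (≡⇒≈ (P.cong h (P.sym (LP.unfold-reverse a s)))) ⟩
      negN (length s) (h (reverse (a ∷ s)))     ∎

    antipode-e₁ : ∀ U y → h (U ++ e₁ ∷ y) ≈ negN (length U N.+ length y) (h (reverse y ++ e₁ ∷ reverse U))
    antipode-e₁ [] y = trans (antipode e₁ y) (negN-cong (length y) (≡⇒≈ (P.cong h (reverse-split [] e₁ y))))
    antipode-e₁ (a ∷ U) y = begin
      h (a ∷ U ++ e₁ ∷ y)
        ≈⟨ antipode a (U ++ e₁ ∷ y) ⟩
      negN (length (U ++ e₁ ∷ y)) (h (reverse (a ∷ U ++ e₁ ∷ y)))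
        ≈⟨ ≡⇒≈ (P.cong₂ (λ t w → negN t (h w)) (P.trans (LP.length-++ U) (NP.+-suc (length U) (length y)))
                                               (reverse-split (a ∷ U) e₁ y)) ⟩
      negN (length (a ∷ U) N.+ length y) (h (reverse y ++ e₁ ∷ reverse (a ∷ U))) ∎

    lie-e₁-⧢e₀ : ∀ x y → (λ x' → h (x' ++ e₁ ∷ y)) [ x ⧢e₀^ 1 ] + (λ y' → h (x ++ e₁ ∷ y')) [ y ⧢e₀^ 1 ] ≈ 0#
    lie-e₁-⧢e₀ x y = begin
      (λ x' → h (x' ++ e₁ ∷ y)) [ x ⧢e₀^ 1 ] + (λ y' → h (x ++ e₁ ∷ y')) [ y ⧢e₀^ 1 ]
        ≈⟨ +-comm _ _ ⟩
      (λ y' → h (x ++ e₁ ∷ y')) [ y ⧢e₀^ 1 ] + (λ x' → h (x' ++ e₁ ∷ y)) [ x ⧢e₀^ 1 ]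
        ≈⟨ +-cong (sym (⧢e₀^0 (λ x' → (λ y' → h (x' ++ e₁ ∷ y')) [ y ⧢e₀^ 1 ]) x))
                  (trans (⧢-cong x 1 (λ x' → sym (⧢e₀^0 (λ y' → h (x' ++ e₁ ∷ y')) y))) (sym (+-identityʳ _))) ⟩
      ∑< 2 (λ a → (λ x' → (λ y' → h (x' ++ e₁ ∷ y')) [ y ⧢e₀^ 1 ∸ a ]) [ x ⧢e₀^ a ])
        ≈⟨ sym (⧢-split x e₁ y h 1) ⟩
      h [ x ++ e₁ ∷ y ⧢e₀^ 1 ]
        ≈⟨ lie-⧢ (x ++ e₁ ∷ y) (e₀ ∷ []) x++e₁y≢[] (λ ()) ⟩
      0# ∎
      where
      x++e₁y≢[] : ¬ (x ++ e₁ ∷ y ≡ [])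
      x++e₁y≢[] eq with LP.++-conicalʳ x (e₁ ∷ y) eq
      ... | ()

    module Exchange (U V : Word) where

      Φ : ℕ → ℕ → Carrier
      Φ a b = (λ x → (λ y → h (x ++ e₁ ∷ y)) [ V ⧢e₀^ b ]) [ U ⧢e₀^ a ]

      -- Shuffle one more e₀ into  (U ⧢ e₀ᵃ) e₁ (V ⧢ e₀ᵇ)  and apply lie-e₁-⧢e₀.
      Φ-recurrence : ∀ a b → suc a × Φ (suc a) b + suc b × Φ a (suc b) ≈ 0#
      Φ-recurrence a b = begin
        suc a × Φ (suc a) b + suc b × Φ a (suc b)
          ≈⟨ +-cong (sym (trans (⧢-cong U a (λ x → ⧢-swap (λ y x' → h (x' ++ e₁ ∷ y)) V b x 1)) (⧢e₀^-⧢e₀ U G a)))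
                    (sym (trans (⧢-cong U a (λ x → ⧢e₀^-⧢e₀ V (λ y' → h (x ++ e₁ ∷ y')) b)) (⧢-× (suc b) _ U a))) ⟩
        (λ x → T₁ x [ V ⧢e₀^ b ]) [ U ⧢e₀^ a ] + (λ x → T₂ x [ V ⧢e₀^ b ]) [ U ⧢e₀^ a ]
          ≈⟨ sym (⧢-+ _ _ U a) ⟩
        (λ x → T₁ x [ V ⧢e₀^ b ] + T₂ x [ V ⧢e₀^ b ]) [ U ⧢e₀^ a ]
          ≈⟨ ⧢-cong U a (λ x → trans (sym (⧢-+ (T₁ x) (T₂ x) V b)) (trans (⧢-cong V b (lie-e₁-⧢e₀ x)) (⧢-0 V b))) ⟩
        (λ x → 0#) [ U ⧢e₀^ a ]
          ≈⟨ ⧢-0 U a ⟩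
        0# ∎
        where
        G : Word → Carrier
        G x' = (λ y → h (x' ++ e₁ ∷ y)) [ V ⧢e₀^ b ]
        T₁ T₂ : Word → Word → Carrier
        T₁ x y = (λ x' → h (x' ++ e₁ ∷ y)) [ x ⧢e₀^ 1 ]
        T₂ x y = (λ y' → h (x ++ e₁ ∷ y')) [ y ⧢e₀^ 1 ]

      -- With the factorial weights  Ψ(a,b) = a! b! Φ(a,b)  the recurrence
      -- becomes Ψ(a+1,b) = -Ψ(a,b+1).
      Ψ : ℕ → ℕ → Carrier
      Ψ a b = (a N.! N.* b N.!) × Φ a b

      Ψ-recurrence : ∀ a b → Ψ (suc a) b + Ψ a (suc b) ≈ 0#
      Ψ-recurrence a b = begin
        Ψ (suc a) b + Ψ a (suc b)
          ≈⟨ +-cong (trans (×-congˡ weight₁) (sym (×-assocˡ _ K (suc a)))) (trans (×-congˡ weight₂) (sym (×-assocˡ _ K (suc b)))) ⟩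
        K × (suc a × Φ (suc a) b) + K × (suc b × Φ a (suc b)) ≈⟨ sym (×-distrib-+ _ _ K) ⟩
        K × (suc a × Φ (suc a) b + suc b × Φ a (suc b))       ≈⟨ ×-congʳ K (Φ-recurrence a b) ⟩
        K × 0#                                                ≈⟨ ×-zeroʳ K ⟩
        0#                                                    ∎
        where
        K = a N.! N.* b N.!
        weight₁ : suc a N.* a N.! N.* b N.! ≡ K N.* suc a
        weight₁ = P.trans (NP.*-assoc (suc a) (a N.!) (b N.!)) (NP.*-comm (suc a) K)
        weight₂ : a N.! N.* (suc b N.* b N.!) ≡ K N.* suc b
        weight₂ = P.trans (P.cong (a N.! N.*_) (NP.*-comm (suc b) (b N.!))) (P.sym (NP.*-assoc (a N.!) (b N.!) (suc b)))

      Ψ-shift : ∀ b a → Ψ a b ≈ negN b (Ψ (a N.+ b) 0)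
      Ψ-shift zero    a = ≡⇒≈ (P.cong (λ t → Ψ t 0) (P.sym (NP.+-identityʳ a)))
      Ψ-shift (suc b) a = begin
        Ψ a (suc b)                  ≈⟨ inverseʳ-unique _ _ (Ψ-recurrence a b) ⟩
        - Ψ (suc a) b                ≈⟨ -‿cong (Ψ-shift b (suc a)) ⟩
        - negN b (Ψ (suc a N.+ b) 0) ≈⟨ ≡⇒≈ (P.cong (λ t → - negN b (Ψ t 0)) (P.sym (NP.+-suc a b))) ⟩
        negN (suc b) (Ψ (a N.+ suc b) 0) ∎

      -- Dividing by n! (possible since ℚ ⊆ R).
      Φ-exchange : ∀ n → Φ 0 n ≈ negN n (Φ n 0)
      Φ-exchange n = ×-cancel (n N.!) {{N.>-nonZero (NP.1≤n! n)}} (begin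
        (n N.!) × Φ 0 n           ≈⟨ ×-congˡ (P.sym (NP.*-identityˡ (n N.!))) ⟩
        Ψ 0 n                     ≈⟨ Ψ-shift n 0 ⟩
        negN n (Ψ n 0)            ≈⟨ negN-cong n (×-congˡ (NP.*-identityʳ (n N.!))) ⟩
        negN n ((n N.!) × Φ n 0)  ≈⟨ negN-× n (n N.!) _ ⟩
        (n N.!) × negN n (Φ n 0)  ∎)

    sign-cancellation : ∀ a n v W → negN a (negN n (negN a (negN (v N.+ n) W))) ≈ negN v W
    sign-cancellation a n v W = begin
      negN a (negN n (negN a (negN (v N.+ n) W))) ≈⟨ negN-cong a (≡⇒≈ (negN-comm n a _)) ⟩
      negN a (negN a (negN n (negN (v N.+ n) W))) ≈⟨ negN-involutive a _ ⟩
      negN n (negN (v N.+ n) W)                   ≈⟨ ≡⇒≈ (P.cong (negN n) (negN-+ v n W)) ⟩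
      negN n (negN v (negN n W))                  ≈⟨ ≡⇒≈ (negN-comm n v _) ⟩
      negN v (negN n (negN n W))                  ≈⟨ negN-cong v (negN-involutive n W) ⟩
      negN v W                                    ∎

    -- The symmetry behind theorem1:
    --   (-1)^|A| h[(rev A ⧢ e₀ⁿ) e₁ B] = (-1)^|B| h[(rev B ⧢ e₀ⁿ) e₁ A] .
    -- Move e₀ⁿ across the e₁ (Φ-exchange), then reverse the whole word (antipode).
    e₁-exchange : ∀ A B n → negN (length A) ((λ z → h (z ++ e₁ ∷ B)) [ reverse A ⧢e₀^ n ])
                          ≈ negN (length B) ((λ z → h (z ++ e₁ ∷ A)) [ reverse B ⧢e₀^ n ])
    e₁-exchange A B n = begin
      negN (length A) ((λ z → h (z ++ e₁ ∷ B)) [ U ⧢e₀^ n ])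
        ≈⟨ ≡⇒≈ (P.cong (λ t → negN t ((λ z → h (z ++ e₁ ∷ B)) [ U ⧢e₀^ n ])) (P.sym (LP.length-reverse A))) ⟩
      negN a ((λ z → h (z ++ e₁ ∷ B)) [ U ⧢e₀^ n ])
        ≈⟨ negN-cong a (⧢-cong U n (λ x → sym (⧢e₀^0 (λ y → h (x ++ e₁ ∷ y)) B))) ⟩
      negN a (Φ n 0)
        ≈⟨ negN-cong a (trans (sym (negN-involutive n _)) (negN-cong n (sym (Φ-exchange n)))) ⟩
      negN a (negN n (Φ 0 n))
        ≈⟨ negN-cong a (negN-cong n (⧢e₀^0 _ U)) ⟩
      negN a (negN n ((λ y → h (U ++ e₁ ∷ y)) [ B ⧢e₀^ n ]))
        ≈⟨ negN-cong a (negN-cong n (⧢-cong B n (λ y → trans (antipode-e₁ U y) (≡⇒≈ (negN-+ a (length y) (G y)))))) ⟩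
      negN a (negN n ((λ y → negN a (negN (length y) (G y))) [ B ⧢e₀^ n ]))
        ≈⟨ negN-cong a (negN-cong n (⧢-negN a _ B n)) ⟩
      negN a (negN n (negN a ((λ y → negN (length y) (G y)) [ B ⧢e₀^ n ])))
        ≈⟨ negN-cong a (negN-cong n (negN-cong a (⧢-length-sign G B n))) ⟩
      negN a (negN n (negN a (negN (length B N.+ n) (G [ B ⧢e₀^ n ]))))
        ≈⟨ sign-cancellation a n (length B) _ ⟩
      negN (length B) (G [ B ⧢e₀^ n ])
        ≈⟨ negN-cong (length B) (⧢-reverse B (λ z → h (z ++ e₁ ∷ reverse U)) n) ⟩
      negN (length B) ((λ z → h (z ++ e₁ ∷ reverse U)) [ reverse B ⧢e₀^ n ])
        ≈⟨ ≡⇒≈ (P.cong (λ w → negN (length B) ((λ z → h (z ++ e₁ ∷ w)) [ reverse B ⧢e₀^ n ])) (LP.reverse-involutive A)) ⟩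
      negN (length B) ((λ z → h (z ++ e₁ ∷ A)) [ reverse B ⧢e₀^ n ]) ∎
      where
      U = reverse A
      a = length U
      open Exchange U B
      G : Word → Carrier
      G y = h (reverse y ++ e₁ ∷ reverse U)

    kernel-symmetric : ∀ u v n → kernel h u v n ≈ kernel h v u n
    kernel-symmetric u v n = begin
      kernel h u v n                                                                      ≈⟨ kernel-⧢ h u v n ⟩
      negN (length (toE u)) ((λ z → h (z ++ e₁ ∷ toE v)) [ reverse (toE u) ⧢e₀^ n ])   ≈⟨ e₁-exchange (toE u) (toE v) n ⟩
      negN (length (toE v)) ((λ z → h (z ++ e₁ ∷ toE u)) [ reverse (toE v) ⧢e₀^ n ])   ≈⟨ sym (kernel-⧢ h v u n) ⟩
      kernel h v u n                                                                      ∎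

theorem1 : ∀ {c ℓ : Level} (R : QAlgebra c ℓ) (h : Series R) → IsLieSeries R h →
           ∀ (w w' : HPoly) (n : ℕ) →
           QAlgebra._≈_ R (coeff R h (ȷρ w' w n)) (coeff R h (ȷρ w w' n))
theorem1 R h lie w w' n = begin
  coeff R h (ȷρ w' w n)
    ≈⟨ coeff-ȷρ h w' w n ⟩
  ∑ w' (λ x → ∑ w (λ y → ι (proj₁ x Q.* proj₁ y) * kernel h (proj₂ x) (proj₂ y) n))
    ≈⟨ ∑-cong w' (λ x → ∑-cong w (λ y → *-cong (ι-cong (QP.*-comm (proj₁ x) (proj₁ y)))
                                                (kernel-symmetric (proj₂ x) (proj₂ y) n))) ⟩
  ∑ w' (λ x → ∑ w (λ y → ι (proj₁ y Q.* proj₁ x) * kernel h (proj₂ y) (proj₂ x) n))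
    ≈⟨ ∑-swap w' w _ ⟩
  ∑ w (λ y → ∑ w' (λ x → ι (proj₁ y Q.* proj₁ x) * kernel h (proj₂ y) (proj₂ x) n))
    ≈⟨ sym (coeff-ȷρ h w w' n) ⟩
  coeff R h (ȷρ w w' n) ∎
  where
  open QAlgebra R
  open Proof R
  open LieSeries h lie
  open import Relation.Binary.Reasoning.Setoid setoid
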